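{- Let $0 < \zeta < 1$ and let $H$ be a graph that has no $\zeta$-sparse cuts. Then, for any $R \subset V(H)$ with $|R| \le (\zeta/6)|H|$ and any distinct vertices $x, y \in V(H) \setminus R$, there exists a path in $H \setminus R$ of length at most $3/\zeta$ with ends $x$ and $y$.
   Context: $|H|$ denotes the number of vertices of $H$. A cut of $V(H)$ is a partition $\{X,Y\}$ of $V(H)$ into two non-empty sets; it is $\zeta$-sparse if the number of edges of $H$ with one end in $X$ and the other in $Y$ is at most $\zeta|X||Y|$. The length of a path is its number of edges.
   Formalization: The parameter ζ is taken rational, with $0 < \zeta < 1$. -}

module Defs where

open import Data.Nat using (ℕ; zero; suc)
open import Data.Bool using (Bool; true; false; _∧_; not; if_then_else_)
open import Data.Fin using (Fin; zero; suc; inject₁; fromℕ)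
open import Data.Fin.Subset using (Subset; _∈_; _∉_; ∁; ∣_∣; Nonempty)
open import Data.Fin.Subset.Properties using (_∈?_)
open import Data.List using (List; map; allFin)
open import Data.Nat.ListAction using (sum)
open import Data.Empty using (⊥)
open import Data.Vec using (Vec; lookup)
open import Data.Integer using (+_)
open import Data.Rational using (ℚ; _/_; _*_; _≤_)
open import Data.Product using (_×_)
open import Relation.Nullary using (does)
open import Relation.Binary.PropositionalEquality using (_≡_)
open import Function.Definitions using (Injective)

-- A finite simple graph on the vertex set Fin n (so |H| = n):
-- symmetric, loopless, decidable adjacency.
record Graph (n : ℕ) : Set where
  field
    adj     : Fin n → Fin n → Bool
    adj-sym : ∀ x y → adj x y ≡ adj y x
    loopless : ∀ x → adj x x ≡ false
open Graph public

ℕ→ℚ : ℕ → ℚ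
ℕ→ℚ k = + k / 1

-- number of edges of H with one end in X and the other in the complement Y = ∁ X
-- (each such edge is counted exactly once, as the ordered pair (x , y) with x ∈ X, y ∉ X)
crossEdges : ∀ {n} → Graph n → Subset n → ℕ
crossEdges {n} H X =
  sum (map (λ x → sum (map (λ y →
    if does (x ∈? X) ∧ not (does (y ∈? X)) ∧ adj H x y then 1 else 0)
    (allFin n))) (allFin n))

IsCut : ∀ {n} → Subset n → Set
IsCut X = Nonempty X × Nonempty (∁ X)

SparseCut : ∀ {n} → ℚ → Graph n → Subset n → Set
SparseCut ζ H X = ℕ→ℚ (crossEdges H X) ≤ ζ * ℕ→ℚ ∣ X ∣ * ℕ→ℚ ∣ ∁ X ∣

NoSparseCut : ∀ {n} → ℚ → Graph n → Set
NoSparseCut ζ H = ∀ X → IsCut X → SparseCut ζ H X → ⊥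

record PathAvoiding {n} (H : Graph n) (R : Subset n) (x y : Fin n) (L : ℕ) : Set where
  field
    vertices : Vec (Fin n) (suc L)
    start    : lookup vertices zero ≡ x
    end      : lookup vertices (fromℕ L) ≡ y
    adjacent : ∀ (i : Fin L) → adj H (lookup vertices (inject₁ i)) (lookup vertices (suc i)) ≡ true
    distinct : Injective _≡_ _≡_ (lookup vertices)
    avoids   : ∀ (i : Fin (suc L)) → lookup vertices i ∉ R

module Submission where

-- Grow balls B_k(c) of radius k around c in H \ R. The cut {B_k, V \ B_k} is not ζ-sparse, every edge
-- leaving B_k ends in B_(k+1) ∪ R, and each vertex there is hit by at most |B_k| of these edges. So the
-- number e_k of vertices outside B_k obeys e_(k+1) < (1 - ζ) e_k + |R|.
-- While e_k ≥ (n + |R|)/2 this lowers e_k by at least ζn/3 per step (as |R| ≤ ζn/6), so after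
-- ⌊3/(2ζ)⌋ steps fewer than (n + |R|)/2 vertices lie outside each of the balls around x and y.
-- Both balls avoid R, hence they meet, and joining the two radii gives a walk, and so a path,
-- from x to y of length at most 3/ζ. Writing ζ = P/Q turns everything into arithmetic in ℕ.

open import Defs
open import Data.Fin.Subset using (Subset)

module Counting where
  open import Data.Bool using (Bool; true; false; not; if_then_else_; _∧_)
  open import Data.Bool.Properties using (∧-conicalˡ; ∧-conicalʳ)
  open import Data.Nat using (ℕ; zero; suc; _+_; _≤_; _<_; z≤n)
  open import Data.Nat.Properties
  open import Data.Fin using (Fin; zero; suc)
  open import Data.Fin.Subset using (Subset; _∉_; ∁; ∣_∣; Nonempty)
  open import Data.Fin.Subset.Properties using (_∈?_)
  open import Data.List using (map; allFin)
  import Data.List as List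
  import Data.List.Properties as List
  import Data.Nat.ListAction as ListAction
  open import Data.Vec using (_∷_; []; lookup; tabulate)
  open import Data.Vec.Properties using (lookup∘tabulate; lookup-map; lookup⇒[]=; []=⇒lookup)
  open import Data.Product using (∃; _×_; _,_)
  open import Function using (_∘_; id)
  open import Relation.Nullary using (does; contradiction)
  open import Relation.Binary.PropositionalEquality
  open import Algebra.Properties.Semiring.Sum +-*-semiring using (sum; sum-cong-≗; ∑-distrib-+)

  𝟙 : Bool → ℕ
  𝟙 b = if b then 1 else 0

  count : ∀ {n} → (Fin n → Bool) → ℕ
  count p = sum (𝟙 ∘ p)

  sum-mono-≤ : ∀ {n} {f g : Fin n → ℕ} → (∀ i → f i ≤ g i) → sum f ≤ sum g
  sum-mono-≤ {zero}  f≤g = z≤n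
  sum-mono-≤ {suc n} f≤g = +-mono-≤ (f≤g zero) (sum-mono-≤ (f≤g ∘ suc))

  sum-+-mono-≤ : ∀ {n} (f g h k : Fin n → ℕ) → (∀ i → f i + g i ≤ h i + k i) → sum f + sum g ≤ sum h + sum k
  sum-+-mono-≤ f g h k pointwise = begin
    sum f + sum g           ≡⟨ ∑-distrib-+ f g ⟨
    sum (λ i → f i + g i)   ≤⟨ sum-mono-≤ pointwise ⟩
    sum (λ i → h i + k i)   ≡⟨ ∑-distrib-+ h k ⟩
    sum h + sum k           ∎
    where open ≤-Reasoning

  listSum-tabulate : ∀ {n} (f : Fin n → ℕ) → ListAction.sum (List.tabulate f) ≡ sum f
  listSum-tabulate {zero}  f = refl
  listSum-tabulate {suc n} f = cong (f zero +_) (listSum-tabulate (f ∘ suc))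

  listSum-allFin : ∀ {n} (f : Fin n → ℕ) → ListAction.sum (map f (allFin n)) ≡ sum f
  listSum-allFin f = trans (cong ListAction.sum (List.map-tabulate id f)) (listSum-tabulate f)

  ∣p∣≡count : ∀ {n} (p : Subset n) → ∣ p ∣ ≡ count (lookup p)
  ∣p∣≡count []          = refl
  ∣p∣≡count (true ∷ p)  = cong suc (∣p∣≡count p)
  ∣p∣≡count (false ∷ p) = ∣p∣≡count p

  ∣tabulate∣≡count : ∀ {n} (p : Fin n → Bool) → ∣ tabulate p ∣ ≡ count p
  ∣tabulate∣≡count p = trans (∣p∣≡count (tabulate p)) (sum-cong-≗ (cong 𝟙 ∘ lookup∘tabulate p))

  ∣∁tabulate∣≡count : ∀ {n} (p : Fin n → Bool) → ∣ ∁ (tabulate p) ∣ ≡ count (not ∘ p)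
  ∣∁tabulate∣≡count p = trans (∣p∣≡count (∁ (tabulate p)))
    (sum-cong-≗ λ i → cong 𝟙 (trans (lookup-map i not (tabulate p)) (cong not (lookup∘tabulate p i))))

  count+count-not : ∀ {n} (p : Fin n → Bool) → count p + count (not ∘ p) ≡ n
  count+count-not {zero}  p = refl
  count+count-not {suc n} p with p zero
  ... | true  = cong suc (count+count-not (p ∘ suc))
  ... | false = trans (+-suc (count (p ∘ suc)) _) (cong suc (count+count-not (p ∘ suc)))

  count>0⇒witness : ∀ {n} (p : Fin n → Bool) → 0 < count p → ∃ λ i → p i ≡ true
  count>0⇒witness {suc n} p pos with p zero in eq
  ... | true  = zero , eq
  ... | false = let (i , pi) = count>0⇒witness (p ∘ suc) pos in suc i , pi

  tabulate-nonempty : ∀ {n} (p : Fin n → Bool) i → p i ≡ true → Nonempty (tabulate p)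
  tabulate-nonempty p i pi = i , lookup⇒[]= i (tabulate p) (trans (lookup∘tabulate p i) pi)

  ∁tabulate-nonempty : ∀ {n} (p : Fin n → Bool) i → not (p i) ≡ true → Nonempty (∁ (tabulate p))
  ∁tabulate-nonempty p i pi = i , lookup⇒[]= i (∁ (tabulate p))
    (trans (lookup-map i not (tabulate p)) (trans (cong not (lookup∘tabulate p i)) pi))

  large-sets-meet : ∀ {n} (a b ρ : Fin n → Bool) →
                    (∀ v → a v ≡ true → ρ v ≡ false) → (∀ v → b v ≡ true → ρ v ≡ false) →
                    count (not ∘ a) + count (not ∘ b) < n + count ρ → ∃ λ v → a v ≡ true × b v ≡ true
  large-sets-meet {n} a b ρ a∩ρ=∅ b∩ρ=∅ small =
    both (count>0⇒witness (λ v → a v ∧ b v) (≰⇒> λ ∣a∩b∣≤0 → <⇒≱ small (begin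
      n + count ρ                                ≡⟨ cong (_+ count ρ) (count+count-not a) ⟨
      count a + count (not ∘ a) + count ρ        ≡⟨ swap (count a) _ _ ⟩
      ∣¬a∣ + (count a + count ρ)                 ≤⟨ +-monoʳ-≤ ∣¬a∣ (sum-+-mono-≤ _ _ _ _ pointwise) ⟩
      ∣¬a∣ + (∣¬b∣ + count (λ v → a v ∧ b v))    ≤⟨ +-monoʳ-≤ ∣¬a∣ (+-monoʳ-≤ ∣¬b∣ ∣a∩b∣≤0) ⟩
      ∣¬a∣ + (∣¬b∣ + 0)                          ≡⟨ cong (∣¬a∣ +_) (+-identityʳ ∣¬b∣) ⟩
      ∣¬a∣ + ∣¬b∣                                ∎)))
    where
    open ≤-Reasoning
    ∣¬a∣ = count (not ∘ a)
    ∣¬b∣ = count (not ∘ b)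
    swap : ∀ x y z → x + y + z ≡ y + (x + z)
    swap x y z = trans (cong (_+ z) (+-comm x y)) (+-assoc y x z)
    both : (∃ λ v → a v ∧ b v ≡ true) → ∃ λ v → a v ≡ true × b v ≡ true
    both (v , ab) = v , ∧-conicalˡ (a v) (b v) ab , ∧-conicalʳ (a v) (b v) ab
    pointwise : ∀ v → 𝟙 (a v) + 𝟙 (ρ v) ≤ 𝟙 (not (b v)) + 𝟙 (a v ∧ b v)
    pointwise v with a v in av | b v in bv | ρ v in ρv
    ... | true  | _     | true  = contradiction (trans (sym ρv) (a∩ρ=∅ v av)) λ ()
    ... | false | true  | true  = contradiction (trans (sym ρv) (b∩ρ=∅ v bv)) λ ()
    ... | true  | true  | false = ≤-refl
    ... | true  | false | false = ≤-refl
    ... | false | false | true  = ≤-refl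
    ... | false | _     | false = z≤n

  does-∈?-tabulate : ∀ {n} (X : Fin n → Bool) v → does (v ∈? tabulate X) ≡ X v
  does-∈?-tabulate X zero with X zero
  ... | true  = refl
  ... | false = refl
  does-∈?-tabulate X (suc v) = does-∈?-tabulate (X ∘ suc) v

  lookup≡false⇒∉ : ∀ {n} {v : Fin n} {p : Subset n} → lookup p v ≡ false → v ∉ p
  lookup≡false⇒∉ pv≡false v∈p = contradiction (trans (sym ([]=⇒lookup v∈p)) pv≡false) λ ()

  ∉⇒lookup≡false : ∀ {n} {v : Fin n} {p : Subset n} → v ∉ p → lookup p v ≡ false
  ∉⇒lookup≡false {v = v} {p} v∉p with lookup p v in pv
  ... | true  = contradiction (lookup⇒[]= v p pv) v∉p
  ... | false = refl

module Cuts where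
  open Counting
  open import Data.Bool using (Bool; true; false; not; _∧_)
  open import Data.Nat using (ℕ; _*_; _≤_; _<_; z≤n)
  open import Data.Nat.Properties using (≤-refl; ≤-trans; ≤-reflexive; +-identityʳ; +-*-semiring; module ≤-Reasoning)
  open import Data.Fin using (Fin)
  open import Data.Fin.Subset using (∁; ∣_∣)
  open import Data.Vec using (tabulate)
  open import Function using (_∘_)
  open import Relation.Binary.PropositionalEquality
  open import Algebra.Properties.Semiring.Sum +-*-semiring using (sum; sum-cong-≗; *-distribʳ-sum; sum-replicate-zero)

  NoSparseCutℕ : ∀ {n} → ℕ → ℕ → Graph n → Set
  NoSparseCutℕ P Q H = ∀ X → IsCut X → P * ∣ X ∣ * ∣ ∁ X ∣ < Q * crossEdges H X

  crossEdges≤∣X∣*∣boundary∣ : ∀ {n} (H : Graph n) (X N : Fin n → Bool) →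
    (∀ x y → X x ≡ true → X y ≡ false → adj H x y ≡ true → N y ≡ true) →
    crossEdges H (tabulate X) ≤ count X * count (λ y → not (X y) ∧ N y)
  crossEdges≤∣X∣*∣boundary∣ {n} H X N edge-lands-in-N = begin
    crossEdges H (tabulate X)                              ≡⟨ as-sum ⟩
    sum (λ x → sum (λ y → 𝟙 (X x ∧ not (X y) ∧ adj H x y))) ≤⟨ sum-mono-≤ row ⟩
    sum (λ x → 𝟙 (X x) * count (λ y → not (X y) ∧ N y))   ≡⟨ *-distribʳ-sum _ (𝟙 ∘ X) ⟨
    count X * count (λ y → not (X y) ∧ N y)                ∎
    where
    open ≤-Reasoning
    as-sum : crossEdges H (tabulate X) ≡ sum (λ x → sum (λ y → 𝟙 (X x ∧ not (X y) ∧ adj H x y)))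
    as-sum = trans (listSum-allFin {n} _) (sum-cong-≗ λ x → trans (listSum-allFin {n} _) (sum-cong-≗ λ y →
      cong₂ (λ a b → 𝟙 (a ∧ not b ∧ adj H x y)) (does-∈?-tabulate X x) (does-∈?-tabulate X y)))
    row : ∀ x → sum (λ y → 𝟙 (X x ∧ not (X y) ∧ adj H x y)) ≤ 𝟙 (X x) * count (λ y → not (X y) ∧ N y)
    row x with X x in Xx
    ... | false = ≤-reflexive (sum-replicate-zero n)
    ... | true  = ≤-trans (sum-mono-≤ entry) (≤-reflexive (sym (+-identityʳ _)))
      where
      entry : ∀ y → 𝟙 (not (X y) ∧ adj H x y) ≤ 𝟙 (not (X y) ∧ N y)
      entry y with X y in Xy | adj H x y in xy
      ... | true  | _     = z≤n
      ... | false | false = z≤n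
      ... | false | true  rewrite edge-lands-in-N x y Xx Xy xy = ≤-refl

module Walks {n} (H : Graph n) (R : Subset n) where
  open import Data.Bool using (true)
  open import Data.Nat using (ℕ; zero; suc; _+_; _≤_; z≤n; s≤s)
  open import Data.Nat.Properties using (≤-refl; ≤-trans; m≤n⇒m≤1+n; +-comm)
  open import Data.Fin using (Fin; zero; suc; inject₁; fromℕ; _≟_)
  open import Data.Fin.Properties using (any?)
  open import Data.Fin.Subset using (_∉_)
  open import Data.Vec using (Vec; _∷_; []; lookup)
  open import Data.Product using (Σ; ∃; _×_; _,_)
  open import Data.Unit using (⊤; tt)
  open import Data.Empty using (⊥-elim)
  open import Relation.Nullary using (¬_; yes; no)
  open import Relation.Binary.PropositionalEquality

  data Walk : Fin n → Fin n → ℕ → Set where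
    [_]  : ∀ {v} → v ∉ R → Walk v v 0
    step : ∀ {u v w L} → u ∉ R → adj H u v ≡ true → Walk v w L → Walk u w (suc L)

  vertices : ∀ {u w L} → Walk u w L → Vec (Fin n) (suc L)
  vertices ([_] {v} _)      = v ∷ []
  vertices (step {u} _ _ p) = u ∷ vertices p

  IsPath : ∀ {u w L} → Walk u w L → Set
  IsPath [ _ ]            = ⊤
  IsPath (step {u} _ _ p) = (∀ i → ¬ lookup (vertices p) i ≡ u) × IsPath p

  start∉R : ∀ {u w L} → Walk u w L → u ∉ R
  start∉R [ u∉R ]        = u∉R
  start∉R (step u∉R _ _) = u∉R

  _++_ : ∀ {u v w L M} → Walk u v L → Walk v w M → Walk u w (L + M)
  [ _ ]        ++ q = q
  step u∉R e p ++ q = step u∉R e (p ++ q)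

  reverse : ∀ {u w L} → Walk u w L → Walk w u L
  reverse [ v∉R ] = [ v∉R ]
  reverse (step {u} {v} {w} {L} u∉R e p) = subst (Walk w u) (+-comm L 1)
    (reverse p ++ step (start∉R p) (trans (adj-sym H v u) e) [ u∉R ])

  vertices-start : ∀ {u w L} (p : Walk u w L) → lookup (vertices p) zero ≡ u
  vertices-start [ _ ]        = refl
  vertices-start (step _ _ _) = refl

  vertices-end : ∀ {u w L} (p : Walk u w L) → lookup (vertices p) (fromℕ L) ≡ w
  vertices-end [ _ ]        = refl
  vertices-end (step _ _ p) = vertices-end p

  vertices-adjacent : ∀ {u w L} (p : Walk u w L) (i : Fin L) →
                      adj H (lookup (vertices p) (inject₁ i)) (lookup (vertices p) (suc i)) ≡ true
  vertices-adjacent (step _ e p) zero    rewrite vertices-start p = e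
  vertices-adjacent (step _ _ p) (suc i) = vertices-adjacent p i

  vertices-avoid : ∀ {u w L} (p : Walk u w L) (i : Fin (suc L)) → lookup (vertices p) i ∉ R
  vertices-avoid [ v∉R ]        zero    = v∉R
  vertices-avoid (step u∉R _ _) zero    = u∉R
  vertices-avoid (step _ _ p)   (suc i) = vertices-avoid p i

  vertices-injective : ∀ {u w L} (p : Walk u w L) → IsPath p →
                       ∀ {i j} → lookup (vertices p) i ≡ lookup (vertices p) j → i ≡ j
  vertices-injective [ _ ]        _          {zero}  {zero}  _  = refl
  vertices-injective (step _ _ p) _          {zero}  {zero}  _  = refl
  vertices-injective (step _ _ p) (u∉p , _)  {zero}  {suc j} eq = ⊥-elim (u∉p j (sym eq))
  vertices-injective (step _ _ p) (u∉p , _)  {suc i} {zero}  eq = ⊥-elim (u∉p i eq)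
  vertices-injective (step _ _ p) (_ , path) {suc i} {suc j} eq = cong suc (vertices-injective p path eq)

  toPathAvoiding : ∀ {u w L} (p : Walk u w L) → IsPath p → PathAvoiding H R u w L
  toPathAvoiding p path = record
    { vertices = vertices p
    ; start    = vertices-start p
    ; end      = vertices-end p
    ; adjacent = vertices-adjacent p
    ; distinct = vertices-injective p path
    ; avoids   = vertices-avoid p
    }

  PathWithin : Fin n → Fin n → ℕ → Set
  PathWithin u w L = ∃ λ M → M ≤ L × Σ (Walk u w M) IsPath

  path-suffix : ∀ {v w z L} (p : Walk v w L) → IsPath p → ∀ i → lookup (vertices p) i ≡ z → PathWithin z w L
  path-suffix {L = L} p path zero refl rewrite vertices-start p = L , ≤-refl , p , path
  path-suffix (step _ _ p) (_ , path) (suc i) eq =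
    let (M , M≤L , q) = path-suffix p path i eq in M , m≤n⇒m≤1+n M≤L , q

  walk⇒path : ∀ {u w L} → Walk u w L → PathWithin u w L
  walk⇒path [ u∉R ] = 0 , z≤n , [ u∉R ] , tt
  walk⇒path (step {u} u∉R e p) with walk⇒path p
  ... | M , M≤L , q , path with any? (λ i → lookup (vertices q) i ≟ u)
  ...   | yes (i , eq) = let (M′ , M′≤M , r) = path-suffix q path i eq in M′ , m≤n⇒m≤1+n (≤-trans M′≤M M≤L) , r
  ...   | no u∉q       = suc M , s≤s M≤L , step u∉R e q , (λ i eq → u∉q (i , eq)) , path

module Balls {n} (H : Graph n) (R : Subset n) where
  open Counting
  open Cuts
  open Walks H R
  open import Data.Bool using (Bool; true; false; not; _∧_; _∨_)
  import Data.Bool.Properties as Bool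
  open import Data.Nat using (ℕ; zero; suc; _+_; _*_; _≤_; _<_; z≤n; s≤s)
  open import Data.Nat.Properties hiding (_≟_)
  open import Data.Fin using (Fin; _≟_)
  open import Data.Fin.Properties using (any?)
  open import Data.Fin.Subset using (_∉_; ∣_∣)
  open import Data.Vec using (lookup; tabulate)
  open import Data.Product using (∃; _×_; _,_; proj₂)
  open import Function using (_∘_)
  open import Relation.Nullary using (does; yes)
  open import Relation.Nullary.Decidable using (dec-true)
  open import Relation.Binary.PropositionalEquality
  open import Algebra.Properties.CommutativeSemigroup *-commutativeSemigroup using (x∙yz≈yx∙z; x∙yz≈y∙xz)

  ball : Fin n → ℕ → Fin n → Bool
  ball c zero    v = does (v ≟ c)
  ball c (suc k) v = ball c k v ∨ (not (lookup R v) ∧ does (any? λ u → ball c k u ∧ adj H v u Bool.≟ true))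

  ball-centre : ∀ c k → ball c k c ≡ true
  ball-centre c zero    = dec-true (c ≟ c) refl
  ball-centre c (suc k) rewrite ball-centre c k = refl

  ball-mono : ∀ c k v → ball c k v ≡ true → ball c (suc k) v ≡ true
  ball-mono c k v v∈B rewrite v∈B = refl

  -- The omitted cases are those in which the hypothesis v∈B has become false ≡ true.
  ball-walk : ∀ {c} → c ∉ R → ∀ k v → ball c k v ≡ true → ∃ λ L → L ≤ k × Walk v c L
  ball-walk {c} c∉R zero v v∈B with v ≟ c
  ... | yes refl = 0 , z≤n , [ c∉R ]
  ball-walk {c} c∉R (suc k) v v∈B with ball c k v in v∈Bₖ
  ... | true = let (L , L≤k , w) = ball-walk c∉R k v v∈Bₖ in L , m≤n⇒m≤1+n L≤k , w
  ... | false with lookup R v in Rv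
  ...   | false with any? (λ u → ball c k u ∧ adj H v u Bool.≟ true)
  ...     | yes (u , e) = let (L , L≤k , w) = ball-walk c∉R k u (Bool.∧-conicalˡ _ _ e) in
                          suc L , s≤s L≤k , step (lookup≡false⇒∉ Rv) (Bool.∧-conicalʳ _ _ e) w

  ball-avoids : ∀ {c} → c ∉ R → ∀ k v → ball c k v ≡ true → lookup R v ≡ false
  ball-avoids c∉R k v v∈B = ∉⇒lookup≡false (start∉R (proj₂ (proj₂ (ball-walk c∉R k v v∈B))))

  ball-boundary : ∀ c k x y → ball c k x ≡ true → ball c k y ≡ false → adj H x y ≡ true →
                  (ball c (suc k) y ∨ lookup R y) ≡ true
  ball-boundary c k x y x∈B y∉B xy rewrite y∉B with lookup R y
  ... | true  = refl
  ... | false rewrite dec-true (any? λ u → ball c k u ∧ adj H y u Bool.≟ true)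
                        (x , cong₂ _∧_ x∈B (trans (adj-sym H y x) xy)) = refl

  outside : Fin n → ℕ → ℕ
  outside c k = count (not ∘ ball c k)

  boundary : Fin n → ℕ → Fin n → Bool
  boundary c k y = not (ball c k y) ∧ (ball c (suc k) y ∨ lookup R y)

  outside-antitone : ∀ c k → outside c (suc k) ≤ outside c k
  outside-antitone c k = sum-mono-≤ λ v → pointwise (ball-mono c k v)
    where
    pointwise : ∀ {a b} → (a ≡ true → b ≡ true) → 𝟙 (not b) ≤ 𝟙 (not a)
    pointwise {true}  a⇒b rewrite a⇒b refl = z≤n
    pointwise {false} {true}  _ = z≤n
    pointwise {false} {false} _ = ≤-refl

  outside≤n : ∀ c k → outside c k ≤ n
  outside≤n c k = ≤-trans (m≤n+m _ (count (ball c k))) (≤-reflexive (count+count-not (ball c k)))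

  boundary+outside≤outside+∣R∣ : ∀ c k → count (boundary c k) + outside c (suc k) ≤ outside c k + ∣ R ∣
  boundary+outside≤outside+∣R∣ c k rewrite ∣p∣≡count R =
    sum-+-mono-≤ _ _ _ _ λ v → pointwise (ball-mono c k v)
    where
    pointwise : ∀ {a b r} → (a ≡ true → b ≡ true) → 𝟙 (not a ∧ (b ∨ r)) + 𝟙 (not b) ≤ 𝟙 (not a) + 𝟙 r
    pointwise {true}          a⇒b rewrite a⇒b refl = z≤n
    pointwise {false} {true}  _ = s≤s z≤n
    pointwise {false} {false} {r} _ = ≤-reflexive (+-comm (𝟙 r) 1)

  shrink : ∀ P Q → NoSparseCutℕ P Q H → ∀ c k → 0 < outside c k →
           P * outside c k + Q * outside c (suc k) < Q * outside c k + Q * ∣ R ∣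
  shrink P Q no-sparse c k e>0 = begin-strict
      P * e + Q * e′      <⟨ +-monoˡ-< (Q * e′) Pe<QG ⟩
      Q * G + Q * e′      ≡⟨ *-distribˡ-+ Q G e′ ⟨
      Q * (G + e′)        ≤⟨ *-monoʳ-≤ Q (boundary+outside≤outside+∣R∣ c k) ⟩
      Q * (e + ∣ R ∣)     ≡⟨ *-distribˡ-+ Q e ∣ R ∣ ⟩
      Q * e + Q * ∣ R ∣   ∎
    where
    open ≤-Reasoning
    X  = tabulate (ball c k)
    f  = count (ball c k)
    e  = outside c k
    e′ = outside c (suc k)
    G  = count (boundary c k)
    cut : IsCut X
    cut = tabulate-nonempty (ball c k) c (ball-centre c k) ,
          ∁tabulate-nonempty (ball c k) _ (proj₂ (count>0⇒witness (not ∘ ball c k) e>0))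
    sparse : P * f * e < Q * crossEdges H X
    sparse = subst₂ (λ a b → P * a * b < Q * crossEdges H X)
                    (∣tabulate∣≡count (ball c k)) (∣∁tabulate∣≡count (ball c k)) (no-sparse X cut)
    Pe<QG : P * e < Q * G
    Pe<QG = *-cancelˡ-< f (P * e) (Q * G) (begin-strict
      f * (P * e)          ≡⟨ x∙yz≈yx∙z f P e ⟩
      P * f * e            <⟨ sparse ⟩
      Q * crossEdges H X   ≤⟨ *-monoʳ-≤ Q (crossEdges≤∣X∣*∣boundary∣ H (ball c k) _ (ball-boundary c k)) ⟩
      Q * (f * G)          ≡⟨ x∙yz≈y∙xz Q f G ⟩
      f * (Q * G)          ∎)

module Arithmetic where
  open import Data.Nat using (ℕ; zero; suc; _+_; _*_; _≤_; _<_; z≤n; s≤s; NonZero; _/_; _%_)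
  open import Data.Nat.DivMod using (m/n*n≤m; m≡m%n+[m/n]*n; m%n<n; m≥n⇒m/n>0)
  open import Data.Nat.Properties
  open import Data.Nat.Tactic.RingSolver using (solve-∀; solve)
  open import Data.List using (_∷_; [])
  open import Data.Product using (∃; _×_; _,_)
  open import Relation.Binary.PropositionalEquality
  open import Algebra.Properties.CommutativeSemigroup *-commutativeSemigroup using (x∙yz≈yx∙z)

  radius : ∀ P Q .{{_ : NonZero P}} → P ≤ Q → ∃ λ k → 2 * P * suc k ≤ 3 * Q × 3 * Q ≤ 2 * P * suc (suc k)
  radius P Q P≤Q = go (3 * Q / (2 * P)) refl (m≥n⇒m/n>0 2P≤3Q)
    where
    instance
      2P≢0 : NonZero (2 * P)
      2P≢0 = m*n≢0 2 P
    2P≤3Q : 2 * P ≤ 3 * Q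
    2P≤3Q = ≤-trans (*-monoʳ-≤ 2 P≤Q) (*-monoˡ-≤ Q (n≤1+n 2))
    go : ∀ K → 3 * Q / (2 * P) ≡ K → 0 < K → ∃ λ k → 2 * P * suc k ≤ 3 * Q × 3 * Q ≤ 2 * P * suc (suc k)
    go (suc k) K≡ _ = k , lower , upper
      where
      open ≤-Reasoning
      lower : 2 * P * suc k ≤ 3 * Q
      lower = begin
        2 * P * suc k       ≡⟨ *-comm (2 * P) (suc k) ⟩
        suc k * (2 * P)     ≡⟨ cong (_* (2 * P)) K≡ ⟨
        3 * Q / (2 * P) * (2 * P) ≤⟨ m/n*n≤m (3 * Q) (2 * P) ⟩
        3 * Q               ∎
      upper : 3 * Q ≤ 2 * P * suc (suc k)
      upper = <⇒≤ (begin-strict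
        3 * Q                             ≡⟨ m≡m%n+[m/n]*n (3 * Q) (2 * P) ⟩
        3 * Q % (2 * P) + 3 * Q / (2 * P) * (2 * P) ≡⟨ cong (λ K → 3 * Q % (2 * P) + K * (2 * P)) K≡ ⟩
        3 * Q % (2 * P) + suc k * (2 * P) <⟨ +-monoˡ-< (suc k * (2 * P)) (m%n<n (3 * Q) (2 * P)) ⟩
        2 * P + suc k * (2 * P)           ≡⟨ *-comm (suc (suc k)) (2 * P) ⟩
        2 * P * suc (suc k)               ∎)

  -- The arithmetic core of below-half: it makes the bound of telescope at k incompatible with 2 e ≥ n + r.
  budget : ∀ P Q n r k → .{{_ : NonZero P}} → 2 * P * suc k ≤ 3 * Q → 3 * Q ≤ 2 * P * suc (suc k) → 6 * Q * r ≤ P * n →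
           2 * Q * n + suc k * (2 * Q * r) ≤ Q * (n + r) + k * (P * (n + r)) + 2 * P * n
  budget P Q n r k lower upper r-small = *-cancelˡ-≤ (2 * P) {{m*n≢0 2 P}} (begin
      2 * P * (2 * Q * n + suc k * (2 * Q * r))    ≡⟨ solve (P ∷ Q ∷ n ∷ r ∷ k ∷ []) ⟩
      4 * P * Q * n + 2 * Q * r * (2 * P * suc k)  ≤⟨ +-monoʳ-≤ (4 * P * Q * n) (*-monoʳ-≤ (2 * Q * r) lower) ⟩
      4 * P * Q * n + 2 * Q * r * (3 * Q)          ≡⟨ solve (P ∷ Q ∷ n ∷ r ∷ []) ⟩
      4 * P * Q * n + Q * (6 * Q * r)              ≤⟨ +-monoʳ-≤ (4 * P * Q * n) (*-monoʳ-≤ Q r-small) ⟩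
      4 * P * Q * n + Q * (P * n)                  ≡⟨ solve (P ∷ Q ∷ n ∷ []) ⟩
      2 * P * Q * n + P * n * (3 * Q)              ≤⟨ +-monoʳ-≤ (2 * P * Q * n) (*-monoʳ-≤ (P * n) upper) ⟩
      2 * P * Q * n + P * n * (2 * P * suc (suc k)) ≤⟨ m≤m+n _ (2 * P * Q * r + 2 * P * (k * (P * r))) ⟩
      2 * P * Q * n + P * n * (2 * P * suc (suc k)) + (2 * P * Q * r + 2 * P * (k * (P * r)))
                                                   ≡⟨ solve (P ∷ Q ∷ n ∷ r ∷ k ∷ []) ⟩
      2 * P * (Q * (n + r) + k * (P * (n + r)) + 2 * P * n) ∎)
    where open ≤-Reasoning

  halves-sum< : ∀ {a b T} → 2 * a < T → 2 * b < T → a + b < T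
  halves-sum< {a} {b} {T} 2a<T 2b<T = *-cancelˡ-< 2 (a + b) T (begin-strict
    2 * (a + b)     ≡⟨ *-distribˡ-+ 2 a b ⟩
    2 * a + 2 * b   <⟨ +-mono-< 2a<T 2b<T ⟩
    T + T           ≡⟨ cong (T +_) (+-identityʳ T) ⟨
    2 * T           ∎)
    where open ≤-Reasoning

  module DecayingSequence (P Q n r : ℕ) (n>0 : 0 < n) (P≤Q : P ≤ Q) (e : ℕ → ℕ)
               (e-antitone : ∀ k → e (suc k) ≤ e k) (e₀≤n : e 0 ≤ n)
               (shrink : ∀ k → 0 < e k → P * e k + Q * e (suc k) < Q * e k + Q * r) where

    large⇒positive : ∀ k → n + r ≤ 2 * e k → 0 < e k
    large⇒positive k T≤2e with e k
    ... | suc _ = s≤s z≤n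
    ... | zero  = ≤-trans n>0 (≤-trans (m≤m+n n r) T≤2e)

    first-step : 0 < e 0 → P * n + Q * e 1 < Q * n + Q * r
    first-step e₀>0 with m≤n⇒∃[o]m+o≡n e₀≤n
    ... | d , refl = begin-strict
        P * (e 0 + d) + Q * e 1     ≡⟨ regroup P Q (e 0) (e 1) d ⟩
        P * e 0 + Q * e 1 + P * d   <⟨ +-monoˡ-< (P * d) (shrink 0 e₀>0) ⟩
        Q * e 0 + Q * r + P * d     ≤⟨ +-monoʳ-≤ (Q * e 0 + Q * r) (*-monoˡ-≤ d P≤Q) ⟩
        Q * e 0 + Q * r + Q * d     ≡⟨ regroup′ Q (e 0) r d ⟩
        Q * (e 0 + d) + Q * r       ∎
      where
      open ≤-Reasoning
      regroup : ∀ P Q a b d → P * (a + d) + Q * b ≡ P * a + Q * b + P * d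
      regroup = solve-∀
      regroup′ : ∀ Q a r d → Q * a + Q * r + Q * d ≡ Q * (a + d) + Q * r
      regroup′ = solve-∀

    -- e 1 < (1 - P/Q) n + r, and every later step with 2 e ≥ n + r lowers 2 Q e by more than P (n + r) - 2 Q r.
    telescope : ∀ k → n + r ≤ 2 * e (suc k) →
                2 * Q * e (suc k) + k * (P * (n + r)) + 2 * P * n < 2 * Q * n + suc k * (2 * Q * r)
    telescope zero T≤2e₁ = begin-strict
        2 * Q * e 1 + 0 + 2 * P * n   ≡⟨ double P Q n (e 1) ⟩
        2 * (P * n + Q * e 1)         <⟨ *-monoʳ-< 2 (first-step e₀>0) ⟩
        2 * (Q * n + Q * r)           ≡⟨ double′ Q n r ⟩
        2 * Q * n + 1 * (2 * Q * r)   ∎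
      where
      open ≤-Reasoning
      e₀>0 : 0 < e 0
      e₀>0 = large⇒positive 0 (≤-trans T≤2e₁ (*-monoʳ-≤ 2 (e-antitone 0)))
      double : ∀ P Q n a → 2 * Q * a + 0 + 2 * P * n ≡ 2 * (P * n + Q * a)
      double = solve-∀
      double′ : ∀ Q n r → 2 * (Q * n + Q * r) ≡ 2 * Q * n + 1 * (2 * Q * r)
      double′ = solve-∀
    telescope (suc k) T≤2e = begin-strict
        2 * Q * e₂ + suc k * PT + 2 * P * n         ≡⟨ split Q e₂ PT k (2 * P * n) ⟩
        (2 * Q * e₂ + PT) + (k * PT + 2 * P * n)      ≤⟨ +-monoˡ-≤ _ (+-monoʳ-≤ (2 * Q * e₂) PT≤2Pe₁) ⟩
        (2 * Q * e₂ + P * (2 * e₁)) + (k * PT + 2 * P * n)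
                                                      ≡⟨ cong (_+ (k * PT + 2 * P * n)) (pair P Q e₁ e₂) ⟩
        2 * (P * e₁ + Q * e₂) + (k * PT + 2 * P * n)  <⟨ +-monoˡ-< _ (*-monoʳ-< 2 (shrink (suc k) e₁>0)) ⟩
        2 * (Q * e₁ + Q * r) + (k * PT + 2 * P * n)   ≡⟨ merge Q e₁ r (k * PT) (2 * P * n) ⟩
        (2 * Q * e₁ + k * PT + 2 * P * n) + 2 * Q * r <⟨ +-monoˡ-< (2 * Q * r) (telescope k T≤2e₁) ⟩
        (2 * Q * n + suc k * (2 * Q * r)) + 2 * Q * r ≡⟨ +-comm-last (2 * Q * n) (suc k * (2 * Q * r)) (2 * Q * r) ⟩
        2 * Q * n + suc (suc k) * (2 * Q * r)         ∎
      where
      open ≤-Reasoning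
      PT = P * (n + r)
      e₁ = e (suc k)
      e₂ = e (suc (suc k))
      T≤2e₁ : n + r ≤ 2 * e₁
      T≤2e₁ = ≤-trans T≤2e (*-monoʳ-≤ 2 (e-antitone (suc k)))
      e₁>0 : 0 < e₁
      e₁>0 = large⇒positive (suc k) T≤2e₁
      PT≤2Pe₁ : PT ≤ P * (2 * e₁)
      PT≤2Pe₁ = *-monoʳ-≤ P T≤2e₁
      split : ∀ Q a X k Y → 2 * Q * a + suc k * X + Y ≡ (2 * Q * a + X) + (k * X + Y)
      split = solve-∀
      pair : ∀ P Q a b → 2 * Q * b + P * (2 * a) ≡ 2 * (P * a + Q * b)
      pair = solve-∀
      merge : ∀ Q a r X Y → 2 * (Q * a + Q * r) + (X + Y) ≡ (2 * Q * a + X + Y) + 2 * Q * r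
      merge = solve-∀
      +-comm-last : ∀ a b c → a + b + c ≡ a + (c + b)
      +-comm-last = solve-∀

    below-half : ∀ k → .{{_ : NonZero P}} → 2 * P * suc k ≤ 3 * Q → 3 * Q ≤ 2 * P * suc (suc k) → 6 * Q * r ≤ P * n →
                 2 * e (suc k) < n + r
    below-half k lower upper r-small = ≰⇒> λ T≤2e → <-irrefl refl (begin-strict
        Q * (n + r) + k * (P * (n + r)) + 2 * P * n       ≤⟨ +-monoˡ-≤ _ (+-monoˡ-≤ _ (QT≤2Qe T≤2e)) ⟩
        2 * Q * e (suc k) + k * (P * (n + r)) + 2 * P * n <⟨ telescope k T≤2e ⟩
        2 * Q * n + suc k * (2 * Q * r)                   ≤⟨ budget P Q n r k lower upper r-small ⟩
        Q * (n + r) + k * (P * (n + r)) + 2 * P * n       ∎)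
      where
      open ≤-Reasoning
      QT≤2Qe : n + r ≤ 2 * e (suc k) → Q * (n + r) ≤ 2 * Q * e (suc k)
      QT≤2Qe T≤2e = ≤-trans (*-monoʳ-≤ Q T≤2e) (≤-reflexive (x∙yz≈yx∙z Q 2 (e (suc k))))

module ShortPaths where
  open Counting
  open Cuts
  open Arithmetic
  open import Data.Bool using (true)
  open import Data.Nat using (ℕ; suc; _+_; _*_; _≤_; _<_; z≤n; s≤s; NonZero)
  open import Data.Nat.Properties using (≤-trans; +-mono-≤; *-monoˡ-≤; module ≤-Reasoning)
  open import Data.Fin using (Fin; zero; suc)
  open import Data.Nat.Tactic.RingSolver using (solve)
  open import Data.List using (_∷_; [])
  open import Data.Fin.Subset using (_∉_; ∣_∣)
  open import Data.Vec using (lookup)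
  open import Data.Product using (∃; _×_; _,_)
  open import Relation.Binary.PropositionalEquality

  fin⇒positive : ∀ {n} → Fin n → 0 < n
  fin⇒positive zero    = s≤s z≤n
  fin⇒positive (suc _) = s≤s z≤n

  module _ {n} (H : Graph n) (R : Subset n) (P Q : ℕ) .{{_ : NonZero P}} (P≤Q : P ≤ Q)
           (no-sparse : NoSparseCutℕ P Q H) (R-small : 6 * Q * ∣ R ∣ ≤ P * n) where
    open Balls H R
    open Walks H R

    module _ (k : ℕ) (lower : 2 * P * suc k ≤ 3 * Q) (upper : 3 * Q ≤ 2 * P * suc (suc k)) where

      outside-small : ∀ c → 2 * outside c (suc k) < n + ∣ R ∣
      outside-small c = DecayingSequence.below-half P Q n ∣ R ∣ (fin⇒positive c) P≤Q (outside c) (outside-antitone c)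
                          (outside≤n c 0) (shrink P Q no-sparse c) k lower upper R-small

      balls-meet : ∀ {x y} → x ∉ R → y ∉ R → ∃ λ v → ball x (suc k) v ≡ true × ball y (suc k) v ≡ true
      balls-meet {x} {y} x∉R y∉R = large-sets-meet (ball x (suc k)) (ball y (suc k)) (lookup R)
        (ball-avoids x∉R (suc k)) (ball-avoids y∉R (suc k))
        (subst (λ r → outside x (suc k) + outside y (suc k) < n + r) (∣p∣≡count R)
               (halves-sum< {outside x (suc k)} {outside y (suc k)} (outside-small x) (outside-small y)))

      path-within-diameter : ∀ {x y} → x ∉ R → y ∉ R → PathWithin x y (suc k + suc k)
      path-within-diameter x∉R y∉R =
        let v , v∈Bx , v∈By = balls-meet x∉R y∉R
            L₁ , L₁≤K , v⇝x = ball-walk x∉R (suc k) v v∈Bx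
            L₂ , L₂≤K , v⇝y = ball-walk y∉R (suc k) v v∈By
            L , L≤L₁+L₂ , x⇝y = walk⇒path (reverse v⇝x ++ v⇝y)
        in L , ≤-trans L≤L₁+L₂ (+-mono-≤ L₁≤K L₂≤K) , x⇝y

    short-path : ∀ x y → x ∉ R → y ∉ R → ∃ λ L → L * P ≤ 3 * Q × PathAvoiding H R x y L
    short-path x y x∉R y∉R =
      let k , lower , upper = radius P Q P≤Q
          L , L≤2K , x⇝y , x⇝y-is-path = path-within-diameter k lower upper x∉R y∉R
      in L , length-bound k lower L≤2K , toPathAvoiding x⇝y x⇝y-is-path
      where
      length-bound : ∀ {L} k → 2 * P * suc k ≤ 3 * Q → L ≤ suc k + suc k → L * P ≤ 3 * Q
      length-bound {L} k lower L≤2K = begin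
        L * P                 ≤⟨ *-monoˡ-≤ P L≤2K ⟩
        (suc k + suc k) * P   ≡⟨ solve (k ∷ P ∷ []) ⟩
        2 * P * suc k         ≤⟨ lower ⟩
        3 * Q                 ∎
        where
        open ≤-Reasoning

module Fractions where
  open import Data.Nat using (ℕ; suc; _+_; _*_; _≤_; _<_)
  open import Data.Nat.Properties using (≰⇒>; *-identityʳ; +-identityʳ)
  open import Data.Nat.Tactic.RingSolver using (solve-∀)
  open import Data.Nat.Coprimality using (Coprime)
  open import Data.Integer as ℤ using (+_)
  import Data.Integer.Properties as ℤ
  open import Data.Rational using (ℚ; mkℚ; toℚᵘ; 1/_; _÷_; 0ℚ; 1ℚ; positive)
    renaming (_≤_ to _≤ℚ_; _<_ to _<ℚ_; _*_ to _*ℚ_)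
  open import Data.Rational.Properties using (toℚᵘ-fromℚᵘ; toℚᵘ-homo-*; toℚᵘ-mono-≤; toℚᵘ-cancel-≤; toℚᵘ-mono-<; pos⇒nonZero)
  open import Data.Rational.Unnormalised as ℚᵘ using (ℚᵘ; mkℚᵘ; _≃_; *≡*; *≤*; *<*)
  import Data.Rational.Unnormalised.Properties as ℚᵘ
  open import Relation.Binary.PropositionalEquality
  open import Relation.Nullary using (¬_)

  infix 7 _/1+_

  _/1+_ : ℕ → ℕ → ℚᵘ
  a /1+ b = mkℚᵘ (+ a) b

  /1+-mono-≤ : ∀ {a b c d} → a * suc d ≤ c * suc b → a /1+ b ℚᵘ.≤ c /1+ d
  /1+-mono-≤ {a} {b} {c} {d} ad≤cb = *≤* (subst₂ ℤ._≤_ (ℤ.pos-* a (suc d)) (ℤ.pos-* c (suc b)) (ℤ.+≤+ ad≤cb))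

  /1+-cancel-≤ : ∀ {a b c d} → a /1+ b ℚᵘ.≤ c /1+ d → a * suc d ≤ c * suc b
  /1+-cancel-≤ {a} {b} {c} {d} (*≤* ad≤cb) =
    ℤ.drop‿+≤+ (subst₂ ℤ._≤_ (sym (ℤ.pos-* a (suc d))) (sym (ℤ.pos-* c (suc b))) ad≤cb)

  /1+-cancel-< : ∀ {a b c d} → a /1+ b ℚᵘ.< c /1+ d → a * suc d < c * suc b
  /1+-cancel-< {a} {b} {c} {d} (*<* ad<cb) =
    ℤ.drop‿+<+ (subst₂ ℤ._<_ (sym (ℤ.pos-* a (suc d))) (sym (ℤ.pos-* c (suc b))) ad<cb)

  /1+-* : ∀ a b c d → (a /1+ b) ℚᵘ.* (c /1+ d) ≃ (a * c) /1+ (d + b * suc d)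
  /1+-* a b c d = *≡* (cong (ℤ._* (+ suc (d + b * suc d))) (sym (ℤ.pos-* a c)))

  toℚᵘ-ℕ→ℚ : ∀ k → toℚᵘ (ℕ→ℚ k) ≃ k /1+ 0
  toℚᵘ-ℕ→ℚ k = toℚᵘ-fromℚᵘ (k /1+ 0)

  toℚᵘ-* : ∀ {x y a b c d} → toℚᵘ x ≃ a /1+ b → toℚᵘ y ≃ c /1+ d → toℚᵘ (x *ℚ y) ≃ (a * c) /1+ (d + b * suc d)
  toℚᵘ-* {x} {y} {a} {b} {c} {d} x≃ y≃ =
    ℚᵘ.≃-trans (toℚᵘ-homo-* x y) (ℚᵘ.≃-trans (ℚᵘ.*-cong x≃ y≃) (/1+-* a b c d))

  ≤-by-cross-multiplication : ∀ {x y a b c d} → toℚᵘ x ≃ a /1+ b → toℚᵘ y ≃ c /1+ d →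
                              a * suc d ≤ c * suc b → x ≤ℚ y
  ≤-by-cross-multiplication x≃ y≃ ad≤cb =
    toℚᵘ-cancel-≤ (ℚᵘ.≤-respˡ-≃ (ℚᵘ.≃-sym x≃) (ℚᵘ.≤-respʳ-≃ (ℚᵘ.≃-sym y≃) (/1+-mono-≤ ad≤cb)))

  ≤⇒cross-multiplied : ∀ {x y a b c d} → toℚᵘ x ≃ a /1+ b → toℚᵘ y ≃ c /1+ d →
                       x ≤ℚ y → a * suc d ≤ c * suc b
  ≤⇒cross-multiplied x≃ y≃ x≤y = /1+-cancel-≤ (ℚᵘ.≤-respˡ-≃ x≃ (ℚᵘ.≤-respʳ-≃ y≃ (toℚᵘ-mono-≤ x≤y)))

  module PositiveFraction (p q : ℕ) .(cop : Coprime (suc p) (suc q)) where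

    ζ : ℚ
    ζ = mkℚ (+ suc p) q cop

    ζ<1⇒p<q : ζ <ℚ 1ℚ → suc p < suc q
    ζ<1⇒p<q ζ<1 = subst₂ _<_ (*-identityʳ (suc p)) (+-identityʳ (suc q)) (/1+-cancel-< (toℚᵘ-mono-< ζ<1))

    non-sparse⇒ℕ : ∀ c a b → ¬ (ℕ→ℚ c ≤ℚ ζ *ℚ ℕ→ℚ a *ℚ ℕ→ℚ b) → suc p * a * b < suc q * c
    non-sparse⇒ℕ c a b not-sparse = ≰⇒> λ Pab≤Qc → not-sparse (≤-by-cross-multiplication
      (toℚᵘ-ℕ→ℚ c) (toℚᵘ-* (toℚᵘ-* ℚᵘ.≃-refl (toℚᵘ-ℕ→ℚ a)) (toℚᵘ-ℕ→ℚ b))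
      (subst₂ _≤_ (lhs-normal c q) (sym (*-identityʳ (suc p * a * b))) Pab≤Qc))
      where
      lhs-normal : ∀ c q → (1 + q) * c ≡ c * (1 + (q * 1) * 1)
      lhs-normal = solve-∀

    ≤ζ/6⇒ℕ : ∀ r n → ℕ→ℚ r ≤ℚ (ζ ÷ ℕ→ℚ 6) *ℚ ℕ→ℚ n → 6 * suc q * r ≤ suc p * n
    ≤ζ/6⇒ℕ r n r≤ = subst₂ _≤_ (lhs-normal r q) (rhs-normal (suc p) n)
      (≤⇒cross-multiplied (toℚᵘ-ℕ→ℚ r) (toℚᵘ-* (toℚᵘ-* {ζ} {1/ ℕ→ℚ 6} ℚᵘ.≃-refl ℚᵘ.≃-refl) (toℚᵘ-ℕ→ℚ n)) r≤)
      where
      lhs-normal : ∀ r q → r * (1 + (5 + q * 6) * 1) ≡ 6 * (1 + q) * r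
      lhs-normal = solve-∀
      rhs-normal : ∀ a n → a * 1 * n * 1 ≡ a * n
      rhs-normal = solve-∀

    ℕ⇒≤3/ζ : (ζ>0 : 0ℚ <ℚ ζ) → ∀ L → L * suc p ≤ 3 * suc q →
             ℕ→ℚ L ≤ℚ _÷_ (ℕ→ℚ 3) ζ {{pos⇒nonZero ζ {{positive ζ>0}}}}
    ℕ⇒≤3/ζ ζ>0 L LP≤3Q = ≤-by-cross-multiplication
      (toℚᵘ-ℕ→ℚ L) (toℚᵘ-* {ℕ→ℚ 3} {1/_ ζ {{pos⇒nonZero ζ {{positive ζ>0}}}}} (toℚᵘ-ℕ→ℚ 3) ℚᵘ.≃-refl)
      (subst₂ _≤_ (cong (λ d → L * suc d) (sym (+-identityʳ p))) (sym (*-identityʳ (3 * suc q))) LP≤3Q)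

open Fractions
open ShortPaths
open Cuts using (NoSparseCutℕ)
open import Data.Nat using (ℕ)
open import Data.Fin using (Fin)
open import Data.Fin.Subset using (Subset; _∉_; ∣_∣; ∁)
open import Data.Rational using (ℚ; 0ℚ; 1ℚ; _<_; _≤_; _*_; _÷_; positive; mkℚ; *<*)
open import Data.Rational.Properties using (pos⇒nonZero)
open import Data.Integer using (+<+; +[1+_]; +0; -[1+_])
open import Data.Product using (∃; _×_; _,_)
open import Relation.Nullary using (¬_)
open import Relation.Binary.PropositionalEquality using (_≡_)
import Data.Nat as ℕ
import Data.Nat.Properties as ℕ

proposition4p2 : (ζ : ℚ) → (ζ>0 : 0ℚ < ζ) → ζ < 1ℚ →
  ∀ {n} (H : Graph n) → NoSparseCut ζ H →
  ∀ (R : Subset n) → ℕ→ℚ ∣ R ∣ ≤ (ζ ÷ ℕ→ℚ 6) * ℕ→ℚ n →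
  ∀ (x y : Fin n) → ¬ x ≡ y → x ∉ R → y ∉ R →
  ∃ λ (L : ℕ) → (ℕ→ℚ L ≤ _÷_ (ℕ→ℚ 3) ζ {{pos⇒nonZero ζ {{positive ζ>0}}}}) × PathAvoiding H R x y L
proposition4p2 (mkℚ +0         _ _) (*<* (+<+ ()))
proposition4p2 (mkℚ -[1+ _ ]   _ _) (*<* ())
proposition4p2 (mkℚ +[1+ p ] q cop) ζ>0 ζ<1 H no-sparse R R-small x y _ x∉R y∉R =
  let L , L*P≤3Q , path = short-path H R (ℕ.suc p) (ℕ.suc q) (ℕ.<⇒≤ (ζ<1⇒p<q ζ<1)) no-sparseℕ
                                     (≤ζ/6⇒ℕ ∣ R ∣ _ R-small) x y x∉R y∉R
  in L , ℕ⇒≤3/ζ ζ>0 L L*P≤3Q , path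
  where
  open PositiveFraction p q cop
  no-sparseℕ : NoSparseCutℕ (ℕ.suc p) (ℕ.suc q) H
  no-sparseℕ X cut = non-sparse⇒ℕ (crossEdges H X) ∣ X ∣ ∣ ∁ X ∣ (no-sparse X cut)
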